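{- Let $G$ be a digraph whose arcs are colored with two colors, $1$ and $2$, and suppose $G$ has a bikernel by monochromatic paths $B\subseteq V(G)$. Then each of the following conditions on a vertex $v\in V(G)$ is sufficient for $v\in B$: (1) $v$ is a 1-sink, i.e. $\delta_1^+(v)=0$; (2) $v$ is a 2-source, i.e. $\delta_2^-(v)=0$; (3) $v$ has out-degree, in-degree, 1-degree or 2-degree equal to zero.
   Context: A bicolored digraph is a finite digraph each of whose arcs is colored $1$ or $2$; $A_i$ denotes the set of arcs of color $i$. A path is monochromatic of color $i$ if all its arcs have color $i$. For a vertex $v$: $\delta_i^+(v)$ is the number of arcs of color $i$ leaving $v$, $\delta_i^-(v)$ the number of arcs of color $i$ entering $v$, the out-degree is $\delta^+(v)=\delta_1^+(v)+\delta_2^+(v)$, the in-degree is $\delta^-(v)=\delta_1^-(v)+\delta_2^-(v)$, and the $i$-degree is $\delta_i(v)=\delta_i^+(v)+\delta_i^-(v)$. A non-empty set $B\subseteq V(G)$ is a bikernel by monochromatic paths (bikernel) if: (i) for all distinct $u,v\in B$ there is no monochromatic directed $uv$-path; (ii) for every $v\in V(G)\setminus B$ there is a directed path of color $1$ from $v$ to some vertex of $B$; (iii) for every $v\in V(G)\setminus B$ there is a directed path of color $2$ from some vertex of $B$ to $v$. -}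

module Defs where

open import Data.Nat using (ℕ; zero; suc; _+_)
open import Data.Fin using (Fin)
open import Data.Fin.Subset using (Subset; _∈_; _∉_; Nonempty)
open import Data.List using (List; []; _∷_; map; allFin)
open import Data.Nat.ListAction using (sum)
open import Data.List.Relation.Unary.Unique.Propositional using (Unique)
open import Data.Maybe using (Maybe; just; nothing)
open import Data.Bool using (Bool; true; false; if_then_else_)
open import Data.Product using (Σ; ∃; _×_; _,_)
open import Relation.Binary.PropositionalEquality using (_≡_)
open import Relation.Nullary using (¬_)

data Color : Set where
  c1 c2 : Color

-- A finite bicoloured digraph on vertex set Fin n: for each ordered pair
-- (u , w) there is either no arc (nothing) or exactly one arc u → w with a
-- colour (just i).  Loops are permitted (they do not affect the theorem).
BicoloredDigraph : ℕ → Set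
BicoloredDigraph n = Fin n → Fin n → Maybe Color

module _ {n : ℕ} (G : BicoloredDigraph n) where

  Arc : Color → Fin n → Fin n → Set
  Arc i u w = G u w ≡ just i

  data MonoWalk (i : Color) : Fin n → Fin n → Set where
    stop : ∀ {u} → MonoWalk i u u
    step : ∀ {u w v} → Arc i u w → MonoWalk i w v → MonoWalk i u v

  walkVertices : ∀ {i u v} → MonoWalk i u v → List (Fin n)
  walkVertices {u = u} stop = u ∷ []
  walkVertices {u = u} (step _ p) = u ∷ walkVertices p

  MonoPath : Color → Fin n → Fin n → Set
  MonoPath i u v = Σ (MonoWalk i u v) (λ p → Unique (walkVertices p))

  isColor : Maybe Color → Color → Bool
  isColor (just c1) c1 = true
  isColor (just c2) c2 = true
  isColor _ _ = false

  indicator : Bool → ℕ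
  indicator b = if b then 1 else 0

  outDeg : Color → Fin n → ℕ
  outDeg i v = sum (map (λ w → indicator (isColor (G v w) i)) (allFin n))

  inDeg : Color → Fin n → ℕ
  inDeg i v = sum (map (λ w → indicator (isColor (G w v) i)) (allFin n))

  outDegree : Fin n → ℕ
  outDegree v = outDeg c1 v + outDeg c2 v

  inDegree : Fin n → ℕ
  inDegree v = inDeg c1 v + inDeg c2 v

  colorDegree : Color → Fin n → ℕ
  colorDegree i v = outDeg i v + inDeg i v

  record IsBikernel (B : Subset n) : Set where
    field
      nonempty    : Nonempty B
      independent : ∀ {u v} → u ∈ B → v ∈ B → ¬ (u ≡ v) → ∀ i → ¬ MonoPath i u v
      absorbing1  : ∀ v → v ∉ B → ∃ λ b → b ∈ B × MonoPath c1 v b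
      dominating2 : ∀ v → v ∉ B → ∃ λ b → b ∈ B × MonoPath c2 b v

-- A vertex v outside B is joined to B by a colour-1 path starting at v and by a
-- colour-2 path ending at v; both paths are non-trivial, so v has a colour-1 arc
-- leaving it and a colour-2 arc entering it.  Hence a 1-sink or a 2-source lies in B,
-- and each degree condition of (3) makes δ₁⁺(v) or δ₂⁻(v) vanish.
module Submission where

open import Defs
open import Data.Nat using (ℕ)
open import Data.Nat.Properties using (m+n≡0⇒m≡0; m+n≡0⇒n≡0; 1+n≢0)
open import Data.Nat.ListAction using (sum)
open import Data.Fin using (Fin)
open import Data.Fin.Subset using (Subset; _∈_)
open import Data.Fin.Subset.Properties using (_∈?_)
open import Data.Sum using (_⊎_; inj₁; inj₂)
open import Data.Product using (_×_; _,_; ∃)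
open import Data.List using (List; _∷_)
open import Data.List.Relation.Unary.Any using (here; there)
import Data.List.Membership.Propositional as List
open import Data.List.Membership.Propositional.Properties using (∈-map⁺; ∈-allFin)
open import Relation.Binary.PropositionalEquality using (_≡_; refl; sym; trans)
open import Relation.Nullary using (¬_)
open import Relation.Nullary.Decidable using (decidable-stable)

sum≡0⇒∈⇒≡0 : ∀ {m} {ns : List ℕ} → sum ns ≡ 0 → m List.∈ ns → m ≡ 0
sum≡0⇒∈⇒≡0 {ns = n ∷ _} eq (here refl) = m+n≡0⇒m≡0 n eq
sum≡0⇒∈⇒≡0 {ns = n ∷ _} eq (there m∈ns) = sum≡0⇒∈⇒≡0 (m+n≡0⇒n≡0 n eq) m∈ns

module _ {n : ℕ} (G : BicoloredDigraph n) where

  Arc⇒counted : ∀ {i u w} → Arc G i u w → indicator G (isColor G (G u w) i) ≡ 1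
  Arc⇒counted {c1} arc rewrite arc = refl
  Arc⇒counted {c2} arc rewrite arc = refl

  outDeg≡0⇒¬Arc : ∀ {i u w} → outDeg G i u ≡ 0 → ¬ Arc G i u w
  outDeg≡0⇒¬Arc {w = w} eq arc =
    1+n≢0 (trans (sym (Arc⇒counted arc)) (sum≡0⇒∈⇒≡0 eq (∈-map⁺ _ (∈-allFin w))))

  inDeg≡0⇒¬Arc : ∀ {i u w} → inDeg G i w ≡ 0 → ¬ Arc G i u w
  inDeg≡0⇒¬Arc {u = u} eq arc =
    1+n≢0 (trans (sym (Arc⇒counted arc)) (sum≡0⇒∈⇒≡0 eq (∈-map⁺ _ (∈-allFin u))))

  MonoWalk⇒≡⊎firstArc : ∀ {i u v} → MonoWalk G i u v → u ≡ v ⊎ ∃ λ w → Arc G i u w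
  MonoWalk⇒≡⊎firstArc stop = inj₁ refl
  MonoWalk⇒≡⊎firstArc (step arc _) = inj₂ (_ , arc)

  MonoWalk⇒≡⊎lastArc : ∀ {i u v} → MonoWalk G i u v → u ≡ v ⊎ ∃ λ w → Arc G i w v
  MonoWalk⇒≡⊎lastArc stop = inj₁ refl
  MonoWalk⇒≡⊎lastArc (step arc p) with MonoWalk⇒≡⊎lastArc p
  ... | inj₁ refl = inj₂ (_ , arc)
  ... | inj₂ lastArc = inj₂ lastArc

  module _ {B : Subset n} (K : IsBikernel G B) where
    open IsBikernel K

    1-sink∈bikernel : ∀ {v} → outDeg G c1 v ≡ 0 → v ∈ B
    1-sink∈bikernel {v} eq = decidable-stable (v ∈? B) ¬v∉B
      where
      ¬v∉B : ¬ ¬ v ∈ B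
      ¬v∉B v∉B with absorbing1 v v∉B
      ... | b , b∈B , (walk , _) with MonoWalk⇒≡⊎firstArc walk
      ...   | inj₁ refl       = v∉B b∈B
      ...   | inj₂ (_ , arc)  = outDeg≡0⇒¬Arc eq arc

    2-source∈bikernel : ∀ {v} → inDeg G c2 v ≡ 0 → v ∈ B
    2-source∈bikernel {v} eq = decidable-stable (v ∈? B) ¬v∉B
      where
      ¬v∉B : ¬ ¬ v ∈ B
      ¬v∉B v∉B with dominating2 v v∉B
      ... | b , b∈B , (walk , _) with MonoWalk⇒≡⊎lastArc walk
      ...   | inj₁ refl       = v∉B b∈B
      ...   | inj₂ (_ , arc)  = inDeg≡0⇒¬Arc eq arc

mainTheorem1 : (n : ℕ) (G : BicoloredDigraph n) (B : Subset n) → IsBikernel G B → (v : Fin n) →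
    ((outDeg G c1 v ≡ 0 → v ∈ B)
    × (inDeg G c2 v ≡ 0 → v ∈ B)
    × (outDegree G v ≡ 0 ⊎ inDegree G v ≡ 0 ⊎ colorDegree G c1 v ≡ 0 ⊎ colorDegree G c2 v ≡ 0 → v ∈ B))
mainTheorem1 n G B K v = 1-sink , 2-source , degree-zero
  where
  1-sink : outDeg G c1 v ≡ 0 → v ∈ B
  1-sink = 1-sink∈bikernel G K
  2-source : inDeg G c2 v ≡ 0 → v ∈ B
  2-source = 2-source∈bikernel G K
  degree-zero : outDegree G v ≡ 0 ⊎ inDegree G v ≡ 0 ⊎ colorDegree G c1 v ≡ 0 ⊎ colorDegree G c2 v ≡ 0 → v ∈ B
  degree-zero (inj₁ δ⁺≡0)               = 1-sink (m+n≡0⇒m≡0 _ δ⁺≡0)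
  degree-zero (inj₂ (inj₁ δ⁻≡0))        = 2-source (m+n≡0⇒n≡0 (inDeg G c1 v) δ⁻≡0)
  degree-zero (inj₂ (inj₂ (inj₁ δ₁≡0))) = 1-sink (m+n≡0⇒m≡0 _ δ₁≡0)
  degree-zero (inj₂ (inj₂ (inj₂ δ₂≡0))) = 2-source (m+n≡0⇒n≡0 (outDeg G c2 v) δ₂≡0)
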